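{- Let $G$ be a finite ordered DAG (every vertex $v$ carries an integer label $v.label$ and every edge $(u,w)$ satisfies $u.label \le w.label$), let $v$ be a vertex of $G$ and let $newLabel$ be an integer with $newLabel < v.label$. Run the procedure $\mathrm{lowerLabel}(G, v, newLabel)$ described in the context. Then: (1) the procedure terminates; (2) after termination, $G$ (with its modified labels) is again an ordered DAG; (3) if $L$ is the multiset of labels of $G$ before the call and $L'$ the multiset of labels after the call, then $L'$ is obtained from $L$ by replacing (one occurrence of) the old value $v.label$ by $newLabel$.
   Context: A labeled DAG is a finite directed acyclic graph $G$ each of whose vertices $v$ has an integer attribute $v.label$. For an edge $(u,w)$, $u$ is a previous neighbour of $w$ and $w$ a next neighbour of $u$. The edge $(u,w)$ is good if $u.label \le w.label$ and bad otherwise; if it is bad, $u$ is called a violating previous neighbour of $w$. $G$ is ordered if all its edges are good. The subroutine $\mathrm{getLargestViolating}(G, x)$ returns a violating previous neighbour $u$ of $x$ whose label is largest among all violating previous neighbours of $x$ (ties broken arbitrarily), or returns null if $x$ has no violating previous neighbour. The procedure $\mathrm{lowerLabel}(G, v, newLabel)$: set $v.label := newLabel$ and $current := v$; then repeat: let $u = \mathrm{getLargestViolating}(G, current)$; if $u$ is null, stop; otherwise exchange the labels of $current$ and $u$ and set $current := u$. -}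

module Defs where

open import Data.Nat using (ℕ)
open import Data.Fin using (Fin; _≟_)
open import Data.Bool using (Bool; T; if_then_else_)
open import Data.Integer using (ℤ; _≤_; _<_)
open import Data.Product using (_×_; _,_; proj₁; proj₂)
open import Data.List using (List; map)
open import Data.List.Base using () renaming (allFin to allFinL)
open import Relation.Nullary using (¬_)
open import Relation.Binary.PropositionalEquality using (_≡_)
open import Relation.Nullary.Decidable using (⌊_⌋)
open import Relation.Binary.Construct.Closure.Transitive using (TransClosure)

Graph : ℕ → Set
Graph n = Fin n → Fin n → Bool

Edge : ∀ {n} → Graph n → Fin n → Fin n → Set
Edge E u w = T (E u w)

Labels : ℕ → Set
Labels n = Fin n → ℤ

Acyclic : ∀ {n} → Graph n → Set
Acyclic {n} E = ∀ (v : Fin n) → ¬ TransClosure (Edge E) v v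

Violating : ∀ {n} → Graph n → Labels n → Fin n → Fin n → Set
Violating E ℓ u w = Edge E u w × ℓ w < ℓ u

Ordered : ∀ {n} → Graph n → Labels n → Set
Ordered {n} E ℓ = ∀ (u w : Fin n) → Edge E u w → ℓ u ≤ ℓ w

-- u is a possible return value of getLargestViolating(G, x):
-- a violating previous neighbour of x of largest label (ties arbitrary).
LargestViolating : ∀ {n} → Graph n → Labels n → Fin n → Fin n → Set
LargestViolating {n} E ℓ x u =
  Violating E ℓ u x × (∀ (u' : Fin n) → Violating E ℓ u' x → ℓ u' ≤ ℓ u)

-- getLargestViolating(G, x) returns null.
NoViolating : ∀ {n} → Graph n → Labels n → Fin n → Set
NoViolating {n} E ℓ x = ∀ (u : Fin n) → ¬ Violating E ℓ u x

update : ∀ {n} → Labels n → Fin n → ℤ → Labels n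
update ℓ v a w = if ⌊ w ≟ v ⌋ then a else ℓ w

swapLabels : ∀ {n} → Labels n → Fin n → Fin n → Labels n
swapLabels ℓ x y w =
  if ⌊ w ≟ x ⌋ then ℓ y else (if ⌊ w ≟ y ⌋ then ℓ x else ℓ w)

-- State of the loop in lowerLabel: current labels and the vertex `current`.
State : ℕ → Set
State n = Labels n × Fin n

-- One iteration of the loop (nondeterministic in the tie-breaking).
Step : ∀ {n} → Graph n → State n → State n → Set
Step E (ℓ , c) (ℓ' , c') = LargestViolating E ℓ c c' × ℓ' ≡ swapLabels ℓ c c'

-- Reverse step, for accessibility (Acc StepRev s : no infinite run from s).
StepRev : ∀ {n} → Graph n → State n → State n → Set
StepRev E s' s = Step E s s'

Halted : ∀ {n} → Graph n → State n → Set
Halted E (ℓ , c) = NoViolating E ℓ c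

initState : ∀ {n} → Labels n → Fin n → ℤ → State n
initState ℓ v a = update ℓ v a , v

-- The list of labels (as a multiset, up to permutation).
labelList : ∀ {n} → Labels n → List ℤ
labelList {n} ℓ = map ℓ (allFinL n)

-- While `current` is c, every edge not entering c is good, and for every path x → c → y
-- we have x.label ≤ y.label.  Swapping c with its largest violating predecessor u re-establishes
-- this at u: the largest violator can replace c's old label without breaking the edges into c,
-- and the path condition at c makes u's old label fit below c's successors.  When no violating
-- predecessor is left the graph is ordered.  The current vertex walks backwards along edges of
-- a finite DAG, so the loop terminates, and swaps never change the multiset of labels.
module Submission where

open import Defs
open import Data.Nat using (ℕ; suc)
open import Data.Fin using (Fin; zero; suc; punchIn; _≟_)
open import Data.Fin.Properties using (punchInᵢ≢i)
open import Data.Fin.Induction using (spo-wellFounded)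
open import Data.Integer using (ℤ; _≤_; _<_)
open import Data.Integer.Properties using (≤-trans; <⇒≤; ≮⇒≥; _<?_)
open import Data.Product using (_×_; _,_; ∃; proj₁; proj₂)
open import Data.List using (List; _∷_; tabulate)
open import Data.List.Properties using (tabulate-cong; map-tabulate)
open import Data.List.Relation.Binary.Permutation.Propositional
  using (_↭_; ↭-refl; ↭-sym; ↭-trans; ↭-prep; ↭-swap; ↭-reflexive)
open import Data.List.Relation.Binary.Permutation.Propositional.Properties using (drop-∷)
open import Function using (_∘_)
open import Induction.WellFounded using (Acc; WellFounded; module Subrelation)
open import Relation.Binary.Construct.Closure.ReflexiveTransitive using (Star; fold)
open import Relation.Binary.Construct.Closure.Transitive
  using (TransClosure; [_]; _∷_; _++_; wellFounded⁻)
import Relation.Binary.Construct.On as On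
open import Relation.Binary.Structures using (IsStrictPartialOrder)
open import Relation.Binary.PropositionalEquality
  using (_≡_; _≢_; refl; sym; trans; cong; cong-app; resp₂; isEquivalence)
open import Relation.Nullary using (¬_; yes; no; contradiction)

star-preserves : ∀ {I : Set} {T : I → I → Set} (P : I → Set) →
  (∀ {i j} → T i j → P i → P j) → ∀ {i j} → Star T i j → P i → P j
star-preserves P preserve = fold (λ i j → P i → P j) (λ t rest → rest ∘ preserve t) (λ p → p)

update-at : ∀ {n} (ℓ : Labels n) v a → update ℓ v a v ≡ a
update-at ℓ v a with v ≟ v
... | yes _ = refl
... | no v≢v = contradiction refl v≢v

update-other : ∀ {n} (ℓ : Labels n) {v w} a → w ≢ v → update ℓ v a w ≡ ℓ w
update-other ℓ {v} {w} a w≢v with w ≟ v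
... | yes w≡v = contradiction w≡v w≢v
... | no _ = refl

swapLabels-atˡ : ∀ {n} (ℓ : Labels n) x y → swapLabels ℓ x y x ≡ ℓ y
swapLabels-atˡ ℓ x y with x ≟ x
... | yes _ = refl
... | no x≢x = contradiction refl x≢x

swapLabels-atʳ : ∀ {n} (ℓ : Labels n) x y → swapLabels ℓ x y y ≡ ℓ x
swapLabels-atʳ ℓ x y with y ≟ x
... | yes refl = refl
... | no _ with y ≟ y
...   | yes _ = refl
...   | no y≢y = contradiction refl y≢y

swapLabels-other : ∀ {n} (ℓ : Labels n) {x y w} → w ≢ x → w ≢ y → swapLabels ℓ x y w ≡ ℓ w
swapLabels-other ℓ {x} {y} {w} w≢x w≢y with w ≟ x
... | yes w≡x = contradiction w≡x w≢x
... | no _ with w ≟ y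
...   | yes w≡y = contradiction w≡y w≢y
...   | no _ = refl

tabulate-↭-punchIn : ∀ {A : Set} {m} (f : Fin (suc m) → A) y →
  tabulate f ↭ f y ∷ tabulate (f ∘ punchIn y)
tabulate-↭-punchIn f zero = ↭-refl
tabulate-↭-punchIn {m = suc m} f (suc y) =
  ↭-trans (↭-prep (f zero) (tabulate-↭-punchIn (f ∘ suc) y)) (↭-swap _ _ ↭-refl)

tabulate-↭-agreeOff : ∀ {A : Set} {n} (f g : Fin n → A) y → (∀ w → w ≢ y → f w ≡ g w) →
  ∃ λ R → tabulate f ↭ f y ∷ R × tabulate g ↭ g y ∷ R
tabulate-↭-agreeOff {n = suc m} f g y agree =
  tabulate (f ∘ punchIn y) ,
  tabulate-↭-punchIn f y ,
  ↭-trans (tabulate-↭-punchIn g y)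
          (↭-reflexive (cong (g y ∷_) (tabulate-cong λ i → sym (agree _ (punchInᵢ≢i y i)))))

labelList-agreeOff : ∀ {n} (ℓ ℓ' : Labels n) y → (∀ w → w ≢ y → ℓ w ≡ ℓ' w) →
  ∃ λ M → labelList ℓ ↭ ℓ y ∷ M × labelList ℓ' ↭ ℓ' y ∷ M
labelList-agreeOff ℓ ℓ' y agree
  rewrite map-tabulate (λ i → i) ℓ | map-tabulate (λ i → i) ℓ' = tabulate-↭-agreeOff ℓ ℓ' y agree

labelList-update : ∀ {n} (ℓ : Labels n) v a →
  ∃ λ M → labelList ℓ ↭ ℓ v ∷ M × labelList (update ℓ v a) ↭ a ∷ M
labelList-update ℓ v a
  with M , ℓ↭ , ℓ'↭ ← labelList-agreeOff ℓ (update ℓ v a) v (λ w w≢v → sym (update-other ℓ a w≢v))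
  rewrite update-at ℓ v a = M , ℓ↭ , ℓ'↭

swapLabels-≗-update : ∀ {n} (ℓ : Labels n) x {y} w → w ≢ y → swapLabels ℓ x y w ≡ update ℓ x (ℓ y) w
swapLabels-≗-update ℓ x {y} w w≢y with w ≟ x
... | yes _ = refl
... | no _ with w ≟ y
...   | yes w≡y = contradiction w≡y w≢y
...   | no _ = refl

-- update ℓ x (ℓ y) differs from ℓ only at x and from the swap only at y, with the value ℓ y
-- at both places.
labelList-swapLabels : ∀ {n} (ℓ : Labels n) {x y} → x ≢ y → labelList (swapLabels ℓ x y) ↭ labelList ℓ
labelList-swapLabels ℓ {x} {y} x≢y
  with M₁ , ℓ↭ , h↭₁ ← labelList-agreeOff ℓ (update ℓ x (ℓ y)) x
                         (λ w w≢x → sym (update-other ℓ (ℓ y) w≢x))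
     | M₂ , k↭ , h↭₂ ← labelList-agreeOff (swapLabels ℓ x y) (update ℓ x (ℓ y)) y
                         (swapLabels-≗-update ℓ x)
  rewrite update-at ℓ x (ℓ y) | update-other ℓ (ℓ y) (x≢y ∘ sym) | swapLabels-atʳ ℓ x y =
  ↭-trans k↭ (↭-trans (↭-prep (ℓ x) (drop-∷ (↭-trans (↭-sym h↭₂) h↭₁))) (↭-sym ℓ↭))

OrderedOutside : ∀ {n} → Graph n → Labels n → Fin n → Set
OrderedOutside E ℓ c = ∀ {x y} → Edge E x y → y ≢ c → ℓ x ≤ ℓ y

OrderedAcross : ∀ {n} → Graph n → Labels n → Fin n → Set
OrderedAcross E ℓ c = ∀ {x y} → Edge E x c → Edge E c y → ℓ x ≤ ℓ y

LoopInvariant : ∀ {n} → Graph n → State n → Set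
LoopInvariant E (ℓ , c) = OrderedOutside E ℓ c × OrderedAcross E ℓ c

invariant-halted⇒ordered : ∀ {n} {E : Graph n} {ℓ c} →
  LoopInvariant E (ℓ , c) → Halted E (ℓ , c) → Ordered E ℓ
invariant-halted⇒ordered {c = c} (outside , _) halted x y x→y with y ≟ c
... | yes refl = ≮⇒≥ (λ y<x → halted x (x→y , y<x))
... | no y≢c = outside x→y y≢c

step⇒edge : ∀ {n} {E : Graph n} {s s' : State n} → Step E s s' → Edge E (proj₂ s') (proj₂ s)
step⇒edge (((c'→c , _) , _) , _) = c'→c

module _ {n} {E : Graph n} (acyclic : Acyclic E) where

  edge⇒≢ : ∀ {x y} → Edge E x y → x ≢ y
  edge⇒≢ {x} x→y refl = acyclic x [ x→y ]

  edge⇒¬reverse : ∀ {x y} → Edge E x y → ¬ Edge E y x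
  edge⇒¬reverse {x} x→y y→x = acyclic x (x→y ∷ [ y→x ])

  edge-wellFounded : WellFounded (Edge E)
  edge-wellFounded = wellFounded⁻ (Edge E) (spo-wellFounded reachability-isStrictPartialOrder)
    where
    reachability-isStrictPartialOrder : IsStrictPartialOrder _≡_ (TransClosure (Edge E))
    reachability-isStrictPartialOrder = record
      { isEquivalence = isEquivalence
      ; irrefl        = λ { {x} refl x→⁺x → acyclic x x→⁺x }
      ; trans         = _++_
      ; <-resp-≈      = resp₂ _
      }

  lowerLabel-terminates : (s : State n) → Acc (StepRev E) s
  lowerLabel-terminates s =
    Subrelation.accessible (step⇒edge {E = E}) (On.accessible proj₂ (edge-wellFounded (proj₂ s)))

  labelList-step : ∀ {s s'} → Step E s s' → labelList (proj₁ s') ↭ labelList (proj₁ s)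
  labelList-step {ℓ , c} (((u→c , _) , _) , refl) = labelList-swapLabels ℓ (edge⇒≢ u→c ∘ sym)

  invariant-init : ∀ {ℓ} → Ordered E ℓ → ∀ {v a} → a < ℓ v → LoopInvariant E (initState ℓ v a)
  invariant-init {ℓ} ordered {v} {a} a<v = outside , across
    where
    outside : OrderedOutside E (update ℓ v a) v
    outside {x} {y} x→y y≢v rewrite update-other ℓ a y≢v with x ≟ v
    ... | yes refl = ≤-trans (<⇒≤ a<v) (ordered x y x→y)
    ... | no _ = ordered x y x→y

    across : OrderedAcross E (update ℓ v a) v
    across {x} {y} x→v v→y
      rewrite update-other ℓ a (edge⇒≢ x→v) | update-other ℓ a (edge⇒≢ v→y ∘ sym) =
      ≤-trans (ordered x v x→v) (ordered v y v→y)

  invariant-step : ∀ {s s'} → Step E s s' → LoopInvariant E s → LoopInvariant E s'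
  invariant-step {ℓ , c} {ℓ' , u} (((u→c , c<u) , largest) , ℓ'≡swap) (outside , across) =
    outside' , across'
    where
    u≢c : u ≢ c
    u≢c = edge⇒≢ u→c

    at-c : ℓ' c ≡ ℓ u
    at-c = trans (cong-app ℓ'≡swap c) (swapLabels-atˡ ℓ c u)

    at-u : ℓ' u ≡ ℓ c
    at-u = trans (cong-app ℓ'≡swap u) (swapLabels-atʳ ℓ c u)

    elsewhere : ∀ {w} → w ≢ c → w ≢ u → ℓ' w ≡ ℓ w
    elsewhere w≢c w≢u = trans (cong-app ℓ'≡swap _) (swapLabels-other ℓ w≢c w≢u)

    predecessor-≤ : ∀ {x} → Edge E x c → ℓ x ≤ ℓ u
    predecessor-≤ {x} x→c with ℓ c <? ℓ x
    ... | yes c<x = largest x (x→c , c<x)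
    ... | no c≮x = ≤-trans (≮⇒≥ c≮x) (<⇒≤ c<u)

    outside' : OrderedOutside E ℓ' u
    outside' {x} {y} x→y y≢u with y ≟ c | x ≟ u
    ... | yes refl | yes refl rewrite at-u | at-c = <⇒≤ c<u
    ... | yes refl | no x≢u rewrite at-c | elsewhere (edge⇒≢ x→y) x≢u = predecessor-≤ x→y
    ... | no y≢c | yes refl rewrite at-u | elsewhere y≢c y≢u =
      ≤-trans (<⇒≤ c<u) (outside x→y y≢c)
    ... | no y≢c | no x≢u with x ≟ c
    ...   | yes refl rewrite at-c | elsewhere y≢c y≢u = across u→c x→y
    ...   | no x≢c rewrite elsewhere x≢c x≢u | elsewhere y≢c y≢u = outside x→y y≢c

    unchanged-before-u : ∀ {x} → Edge E x u → ℓ' x ≡ ℓ x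
    unchanged-before-u x→u = elsewhere (λ { refl → edge⇒¬reverse u→c x→u }) (edge⇒≢ x→u)

    across' : OrderedAcross E ℓ' u
    across' {x} {y} x→u u→y with y ≟ c
    ... | yes refl rewrite unchanged-before-u x→u | at-c = outside x→u u≢c
    ... | no y≢c rewrite unchanged-before-u x→u | elsewhere y≢c (edge⇒≢ u→y ∘ sym) =
      ≤-trans (outside x→u u≢c) (outside u→y y≢c)


  labelList-run : ∀ {s s'} → Star (Step E) s s' → labelList (proj₁ s') ↭ labelList (proj₁ s)
  labelList-run {s} run =
    star-preserves (λ s' → labelList (proj₁ s') ↭ labelList (proj₁ s))
      (λ step ↭start → ↭-trans (labelList-step step) ↭start) run ↭-refl

  lowerLabel-ordered : ∀ {ℓ v a ℓ' c} → Ordered E ℓ → a < ℓ v →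
    Star (Step E) (initState ℓ v a) (ℓ' , c) → Halted E (ℓ' , c) → Ordered E ℓ'
  lowerLabel-ordered ordered a<v run =
    invariant-halted⇒ordered (star-preserves (LoopInvariant E) invariant-step run
                                (invariant-init ordered a<v))

  lowerLabel-relabels : ∀ {ℓ v a s} → Star (Step E) (initState ℓ v a) s →
    ∃ λ M → labelList ℓ ↭ ℓ v ∷ M × labelList (proj₁ s) ↭ a ∷ M
  lowerLabel-relabels {ℓ} {v} {a} run with M , ℓ↭ , updated↭ ← labelList-update ℓ v a =
    M , ℓ↭ , ↭-trans (labelList-run run) updated↭

mainTheorem1 : (n : ℕ) (E : Graph n) (ℓ : Labels n) → Acyclic E → Ordered E ℓ →
    (v : Fin n) (newLabel : ℤ) → newLabel < ℓ v →
    Acc (StepRev E) (initState ℓ v newLabel)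
    × (∀ (s : State n) → Star (Step E) (initState ℓ v newLabel) s → Halted E s →
        Ordered E (proj₁ s)
        × ∃ (λ (M : List ℤ) → (labelList ℓ ↭ ℓ v ∷ M) × (labelList (proj₁ s) ↭ newLabel ∷ M)))
mainTheorem1 n E ℓ acyclic ordered v newLabel newLabel<ℓv =
  lowerLabel-terminates acyclic _ ,
  λ { (ℓ' , c) run halted →
        lowerLabel-ordered acyclic ordered newLabel<ℓv run halted , lowerLabel-relabels acyclic run }
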